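{- Let $T = (V,E)$ be a finite tree and $c \colon \binom{V}{2} \to \mathbb{R}$. For every subtree $S$ of $T$ (a connected subgraph of $T$, with node set $V_S$) let $d_S = \sum_{\{u,v\} \in \binom{V_S}{2}} c_{uv}$. Then a vector $y \in \{0,1\}^E$ is an optimal solution of $$\min_{y \in \{0,1\}^E} \sum_{\{u,v\} \in \binom{V}{2}} c_{uv} \prod_{e \in P_{uv}} y_e$$ if and only if the vector $\lambda$, defined for every subtree $S$ of $T$ by $\lambda_S = 1$ if $S$ is a connected component of the subgraph $(V, \{e \in E : y_e = 1\})$ and $\lambda_S = 0$ otherwise, is an optimal solution of the set partitioning problem $$\min \sum_{S} d_S \lambda_S \quad \text{s.t.} \quad \sum_{S \,:\, u \in V_S} \lambda_S = 1 \ \ \forall u \in V, \qquad \lambda_S \geq 0,\ \lambda_S \in \mathbb{Z} \text{ for all subtrees } S.$$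
   Context: For distinct $u,v \in V$, $P_{uv}$ denotes the set of edges of the unique path in $T$ from $u$ to $v$. The sums over $S$ range over all subtrees (connected subgraphs, including single nodes) of $T$. -}

module Defs where

open import Data.Nat using (ℕ; zero; suc; _<ᵇ_)
open import Data.Bool using (Bool; true; false; if_then_else_; _xor_)
open import Data.Fin using (Fin; zero; suc; toℕ)
open import Data.Fin.Subset using (Subset; _∈_)
open import Data.Vec using (Vec; []; _∷_; lookup)
open import Data.List using (List; []; _∷_; map; _++_; foldr; allFin)
open import Data.Nat.ListAction using (sum; product)
open import Data.Product using (_×_; _,_; proj₁; proj₂; ∃; Σ)
open import Data.Product using () renaming (map to map×)
open import Relation.Binary.PropositionalEquality using (_≡_; _≢_)
open import Relation.Binary.Structures using (IsTotalOrder)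
open import Relation.Nullary using (¬_)
open import Algebra.Structures using (IsAbelianGroup)
open import Function.Bundles using (_⇔_)

-- Scalars: a totally ordered abelian group (ℝ with + and ≤ is an instance).
-- The statement only uses addition, integer multiples and comparison of
-- the costs, so it is stated for every such group.

record OrderedAbelianGroup : Set₁ where
  field
    Carrier        : Set
    _+_            : Carrier → Carrier → Carrier
    0#             : Carrier
    -_             : Carrier → Carrier
    _≤_            : Carrier → Carrier → Set
    isAbelianGroup : IsAbelianGroup _≡_ _+_ 0# -_
    isTotalOrder   : IsTotalOrder _≡_ _≤_
    +-monoʳ-≤      : ∀ z {x y} → x ≤ y → (z + x) ≤ (z + y)

-- A tree with n edges has vertices Fin (suc n) and edges
-- Fin n.  'root' is the one-vertex tree; 'attach t p' adds a new vertex
-- (numbered zero, old vertices shifted by suc) joined by a new edge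
-- (numbered zero, old edges shifted by suc) to the old vertex p.
-- Every finite tree is isomorphic to one built this way.

data Tree : ℕ → Set where
  root   : Tree zero
  attach : ∀ {n} → Tree n → Fin (suc n) → Tree (suc n)

endpoints : ∀ {n} → Tree n → Fin n → Fin (suc n) × Fin (suc n)
endpoints (attach t p) zero    = zero , suc p
endpoints (attach t p) (suc e) = map× suc suc (endpoints t e)

-- is edge e on the (unique) path from vertex v to the original vertex r
-- (the vertex of 'root')?
onRootPath : ∀ {n} → Tree n → Fin (suc n) → Fin n → Bool
onRootPath (attach t p) zero    zero    = true
onRootPath (attach t p) zero    (suc e) = onRootPath t p e
onRootPath (attach t p) (suc v) zero    = false
onRootPath (attach t p) (suc v) (suc e) = onRootPath t v e

-- e ∈ P_uv : the u–v path is the symmetric difference of the u–r and v–r paths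
onPath : ∀ {n} → Tree n → Fin (suc n) → Fin (suc n) → Fin n → Bool
onPath t u v e = onRootPath t u e xor onRootPath t v e

data Reach {n} (t : Tree n) (ok : Fin n → Bool) (S : Subset (suc n))
           (u : Fin (suc n)) : Fin (suc n) → Set where
  here : u ∈ S → Reach t ok S u u
  fwd  : ∀ {w} (e : Fin n) → Reach t ok S u w → ok e ≡ true →
         proj₁ (endpoints t e) ≡ w → proj₂ (endpoints t e) ∈ S →
         Reach t ok S u (proj₂ (endpoints t e))
  bwd  : ∀ {w} (e : Fin n) → Reach t ok S u w → ok e ≡ true →
         proj₂ (endpoints t e) ≡ w → proj₁ (endpoints t e) ∈ S →
         Reach t ok S u (proj₁ (endpoints t e))

Connected : ∀ {n} → Tree n → (Fin n → Bool) → Subset (suc n) → Set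
Connected t ok S =
  (∃ λ u → u ∈ S) × (∀ u v → u ∈ S → v ∈ S → Reach t ok S u v)

-- Subtrees of T (connected subgraphs, incl. single nodes), identified
-- with their node sets V_S (a connected subgraph of a tree is the
-- subgraph induced by its node set).
IsSubtree : ∀ {n} → Tree n → Subset (suc n) → Set
IsSubtree t S = Connected t (λ _ → true) S

IsComponent : ∀ {n} → Tree n → (Fin n → Bool) → Subset (suc n) → Set
IsComponent t y S =
  Connected t y S ×
  (∀ e → y e ≡ true →
     (proj₁ (endpoints t e) ∈ S → proj₂ (endpoints t e) ∈ S) ×
     (proj₂ (endpoints t e) ∈ S → proj₁ (endpoints t e) ∈ S))

allSubsets : ∀ m → List (Subset m)
allSubsets zero    = [] ∷ []
allSubsets (suc m) = map (false ∷_) (allSubsets m) ++ map (true ∷_) (allSubsets m)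

module _ (G : OrderedAbelianGroup) where
  open OrderedAbelianGroup G

  sumG : List Carrier → Carrier
  sumG = foldr _+_ 0#

  _·_ : ℕ → Carrier → Carrier
  zero  · x = 0#
  suc k · x = x + (k · x)

  -- Σ_{ {u,v} ∈ binom(Fin m, 2) } f u v   (each unordered pair once, as u < v)
  sumPairs : ∀ {m} → (Fin m → Fin m → Carrier) → Carrier
  sumPairs {m} f =
    sumG (map (λ u → sumG (map (λ v → if toℕ u <ᵇ toℕ v then f u v else 0#)
                               (allFin m)))
              (allFin m))

  pathProd : ∀ {n} → Tree n → (Fin n → Bool) → Fin (suc n) → Fin (suc n) → ℕ
  pathProd {n} t y u v =
    product (map (λ e → if onPath t u v e then (if y e then 1 else 0) else 1)
                 (allFin n))

  objY : ∀ {n} → Tree n → (Fin (suc n) → Fin (suc n) → Carrier) →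
         (Fin n → Bool) → Carrier
  objY t c y = sumPairs (λ u v → pathProd t y u v · c u v)

  OptimalY : ∀ {n} → Tree n → (Fin (suc n) → Fin (suc n) → Carrier) →
             (Fin n → Bool) → Set
  OptimalY {n} t c y = ∀ (y' : Fin n → Bool) → objY t c y ≤ objY t c y'

  dS : ∀ {n} → (Fin (suc n) → Fin (suc n) → Carrier) → Subset (suc n) → Carrier
  dS c S = sumPairs (λ u v → if lookup S u then (if lookup S v then c u v else 0#) else 0#)

  -- set partitioning problem.  A variable vector assigns a nonnegative
  -- integer to every subtree; it is encoded as a function on all subsets
  -- vanishing outside the subtrees.
  FeasibleSPP : ∀ {n} → Tree n → (Subset (suc n) → ℕ) → Set
  FeasibleSPP {n} t μ =
    (∀ S → μ S ≢ 0 → IsSubtree t S) ×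
    (∀ (u : Fin (suc n)) →
       sum (map (λ S → if lookup S u then μ S else 0) (allSubsets (suc n))) ≡ 1)

  costSPP : ∀ {n} → (Fin (suc n) → Fin (suc n) → Carrier) →
            (Subset (suc n) → ℕ) → Carrier
  costSPP {n} c μ = sumG (map (λ S → μ S · dS c S) (allSubsets (suc n)))

  OptimalSPP : ∀ {n} → Tree n → (Fin (suc n) → Fin (suc n) → Carrier) →
               (Subset (suc n) → ℕ) → Set
  OptimalSPP t c λv =
    FeasibleSPP t λv × (∀ μ → FeasibleSPP t μ → costSPP c λv ≤ costSPP c μ)

-- Write κ_μ(u,v) ('coverage') for the number of chosen subtrees, counted with multiplicity μ,
-- that contain both u and v.  Double counting turns the partitioning cost Σ_S μ_S d_S into
-- Σ_{u<v} κ_μ(u,v) c_uv, so both problems minimise a sum of the same shape, and it suffices to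
-- match their feasible points with κ(u,v) = ∏_{e ∈ P_uv} y_e.  For the components of the
-- y-edges this holds because u and v share a component iff every edge of P_uv has y_e = 1.
-- Conversely, in a feasible μ every vertex lies in exactly one chosen subtree, so sharing a
-- subtree is an equivalence relation and κ is its 0/1 indicator; selecting the edges whose ends
-- share a subtree gives such a y, since a subtree contains the whole path between two of its
-- vertices and a path of selected edges never leaves a class.

module Submission where

open import Defs hiding (_·_)
open import Algebra.Bundles using (AbelianGroup)
open import Data.Bool using (Bool; true; false; if_then_else_; _∧_; _xor_)
open import Data.Bool.Properties
  using (xor-same; xor-comm; ∧-idem; T-≡; if-float; if-eta; if-cong; if-cong-then; if-cong-else)
  renaming (_≟_ to _≟ᵇ_)
open import Data.Fin using (Fin; zero; suc; toℕ)
open import Data.Fin.Properties using (all?; any?; ¬∀⟶∃¬)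
open import Data.Fin.Subset using (Subset; _∈_; ⊤)
open import Data.Fin.Subset.Properties using (drop-there; ∈⊤; ⊆-antisym)
open import Data.List using (List; []; _∷_; _++_; map; allFin)
open import Data.List.Properties using (map-++; map-∘; map-cong)
open import Data.List.Membership.Propositional using () renaming (_∈_ to _∈ˡ_)
open import Data.List.Membership.Propositional.Properties using (∈-map⁺; ∈-++⁺ˡ; ∈-++⁺ʳ; ∈-allFin)
open import Data.List.Relation.Unary.Any using (here; there)
open import Data.Nat as ℕ using (ℕ; zero; suc; _≤_; _<ᵇ_; z≤n)
open import Data.Nat.Divisibility using (0∣⇒≡0)
open import Data.Nat.ListAction using (sum; product)
open import Data.Nat.ListAction.Properties using (sum-++; ∈⇒∣product)
open import Data.Nat.Properties
  using (≤-refl; ≤-trans; ≤-reflexive; <-irrefl; +-mono-≤; m≤m+n; m≤n+m; +-identityʳ;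
         n≤0⇒n≡0; n≢0⇒n>0; n>0⇒n≢0; n≤1⇒n≡0∨n≡1; <ᵇ⇒<; <⇒<ᵇ; module ≤-Reasoning)
  renaming (_≟_ to _≟ℕ_)
open import Data.Product using (_×_; _,_; proj₁; proj₂; ∃)
open import Data.Sum using (_⊎_; inj₁; inj₂)
open import Data.Vec using ([]; _∷_; lookup; tabulate; there)
open import Data.Vec.Properties using (≡-dec; []=⇒lookup; lookup⇒[]=; lookup∘tabulate; ∷-injectiveʳ)
open import Function using (_∘_)
open import Function.Bundles using (_⇔_; mk⇔; Equivalence)
open import Relation.Nullary using (¬_; Dec; yes; no; does; contradiction)
open import Relation.Nullary.Decidable using (_→-dec_; map′; dec-true)
open import Relation.Binary.PropositionalEquality
  using (_≡_; _≢_; refl; sym; trans; cong; cong₂; subst; subst₂; module ≡-Reasoning)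

-- Paths in a tree

source target : ∀ {n} → Tree n → Fin n → Fin (suc n)
source t e = proj₁ (endpoints t e)
target t e = proj₂ (endpoints t e)

onPath-self : ∀ {n} (t : Tree n) u e → onPath t u u e ≡ false
onPath-self t u e = xor-same (onRootPath t u e)

onPath-sym : ∀ {n} (t : Tree n) u v e → onPath t u v e ≡ onPath t v u e
onPath-sym t u v e = xor-comm (onRootPath t u e) (onRootPath t v e)

onPath-split : ∀ {n} (t : Tree n) u w v e →
  onPath t u v e ≡ true → onPath t u w e ≡ true ⊎ onPath t w v e ≡ true
onPath-split t u w v e = xor-split (onRootPath t u e) (onRootPath t w e) (onRootPath t v e)
  where
  xor-split : ∀ a b c → a xor c ≡ true → a xor b ≡ true ⊎ b xor c ≡ true
  xor-split false false c p = inj₂ p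
  xor-split false true  c _ = inj₁ refl
  xor-split true  false c _ = inj₁ refl
  xor-split true  true  c p = inj₂ p

onPath-edge : ∀ {n} (t : Tree n) e e′ → onPath t (source t e) (target t e) e′ ≡ true → e ≡ e′
onPath-edge (attach t p) zero    zero     _ = refl
onPath-edge (attach t p) zero    (suc e′) q with () ← trans (sym (xor-same (onRootPath t p e′))) q
onPath-edge (attach t p) (suc e) zero     ()
onPath-edge (attach t p) (suc e) (suc e′) q = cong suc (onPath-edge t e e′ q)

module _ {n} {t : Tree n} {ok : Fin n → Bool} {S : Subset (suc n)} where

  Reach-target : ∀ {u v} → Reach t ok S u v → v ∈ S
  Reach-target (here u∈S)        = u∈S
  Reach-target (fwd _ _ _ _ v∈S) = v∈S
  Reach-target (bwd _ _ _ _ v∈S) = v∈S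

  Reach-trans : ∀ {u v w} → Reach t ok S u v → Reach t ok S v w → Reach t ok S u w
  Reach-trans r (here _)              = r
  Reach-trans r (fwd e r′ oke eq w∈S) = fwd e (Reach-trans r r′) oke eq w∈S
  Reach-trans r (bwd e r′ oke eq w∈S) = bwd e (Reach-trans r r′) oke eq w∈S

  Reach-sym : ∀ {u v} → Reach t ok S u v → Reach t ok S v u
  Reach-sym (here u∈S)             = here u∈S
  Reach-sym (fwd e r oke refl v∈S) =
    Reach-trans (bwd e (here v∈S) oke refl (Reach-target r)) (Reach-sym r)
  Reach-sym (bwd e r oke refl v∈S) =
    Reach-trans (fwd e (here v∈S) oke refl (Reach-target r)) (Reach-sym r)

  Reach-weaken : ∀ {ok′ u v} → (∀ e → ok e ≡ true → ok′ e ≡ true) →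
    Reach t ok S u v → Reach t ok′ S u v
  Reach-weaken ok⇒ (here u∈S)           = here u∈S
  Reach-weaken ok⇒ (fwd e r oke eq w∈S) = fwd e (Reach-weaken ok⇒ r) (ok⇒ e oke) eq w∈S
  Reach-weaken ok⇒ (bwd e r oke eq w∈S) = bwd e (Reach-weaken ok⇒ r) (ok⇒ e oke) eq w∈S

  Reach-restrict : ∀ {S′ u v} → (∀ {w} → Reach t ok S′ u w → w ∈ S) →
    Reach t ok S′ u v → Reach t ok S u v
  Reach-restrict closed r@(here _)            = here (closed r)
  Reach-restrict closed r@(fwd e r′ oke eq _) = fwd e (Reach-restrict closed r′) oke eq (closed r)
  Reach-restrict closed r@(bwd e r′ oke eq _) = bwd e (Reach-restrict closed r′) oke eq (closed r)

  Reach-closed : ∀ {S′ u v} →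
    (∀ e → ok e ≡ true → (source t e ∈ S → target t e ∈ S) × (target t e ∈ S → source t e ∈ S)) →
    u ∈ S → Reach t ok S′ u v → v ∈ S
  Reach-closed closed u∈S (here _)             = u∈S
  Reach-closed closed u∈S (fwd e r oke refl _) = proj₁ (closed e oke) (Reach-closed closed u∈S r)
  Reach-closed closed u∈S (bwd e r oke refl _) = proj₂ (closed e oke) (Reach-closed closed u∈S r)

PathWithin : ∀ {n} → Tree n → (Fin n → Bool) → Subset (suc n) → Fin (suc n) → Fin (suc n) → Set
PathWithin t ok S u v =
  ∀ e → onPath t u v e ≡ true → ok e ≡ true × source t e ∈ S × target t e ∈ S

module _ {n} {t : Tree n} {ok : Fin n → Bool} {S : Subset (suc n)} where

  Reach⇒PathWithin : ∀ {u v} → Reach t ok S u v → PathWithin t ok S u v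
  Reach⇒PathWithin {u} (here _) e q with () ← trans (sym (onPath-self t u e)) q
  Reach⇒PathWithin {u} (fwd e r oke refl v∈S) e′ q with onPath-split t u (source t e) (target t e) e′ q
  ... | inj₁ q′ = Reach⇒PathWithin r e′ q′
  ... | inj₂ q′ with refl ← onPath-edge t e e′ q′ = oke , Reach-target r , v∈S
  Reach⇒PathWithin {u} (bwd e r oke refl v∈S) e′ q with onPath-split t u (target t e) (source t e) e′ q
  ... | inj₁ q′ = Reach⇒PathWithin r e′ q′
  ... | inj₂ q′ with refl ← onPath-edge t e e′ (trans (onPath-sym t _ _ e′) q′) =
    oke , v∈S , Reach-target r

Reach-lift : ∀ {n} {t : Tree n} {p ok s S u v} →
  Reach t (ok ∘ suc) S u v → Reach (attach t p) ok (s ∷ S) (suc u) (suc v)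
Reach-lift (here u∈S)             = here (there u∈S)
Reach-lift (fwd e r oke refl v∈S) = fwd (suc e) (Reach-lift r) oke refl (there v∈S)
Reach-lift (bwd e r oke refl v∈S) = bwd (suc e) (Reach-lift r) oke refl (there v∈S)

PathWithin-drop : ∀ {n} (t : Tree n) (ok : Fin (suc n) → Bool) {s S u v} →
  (∀ e → onPath t u v e ≡ true →
     ok (suc e) ≡ true × suc (source t e) ∈ s ∷ S × suc (target t e) ∈ s ∷ S) →
  PathWithin t (ok ∘ suc) S u v
PathWithin-drop t ok h e q with h e q
... | oke , x∈ , y∈ = oke , drop-there x∈ , drop-there y∈

-- On an old edge suc e, onPath (attach t p) computes to onPath t with the new vertex zero
-- read as p; this is why h (suc e) restricts the hypothesis to t without further proof.
PathWithin⇒Reach : ∀ {n} (t : Tree n) {ok : Fin n → Bool} {S u v} →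
  u ∈ S → PathWithin t ok S u v → Reach t ok S u v
PathWithin⇒Reach root {u = zero} {zero} u∈S _ = here u∈S
PathWithin⇒Reach (attach t p) {u = zero} {zero} u∈S _ = here u∈S
PathWithin⇒Reach (attach t p) {ok} {S = s ∷ S} {suc u} {suc v} u∈S h =
  Reach-lift (PathWithin⇒Reach t (drop-there u∈S) (PathWithin-drop t ok (λ e → h (suc e))))
PathWithin⇒Reach (attach t p) {ok} {S = s ∷ S} {zero} {suc v} u∈S h with h zero refl
... | ok₀ , _ , p∈S =
  Reach-trans (fwd zero (here u∈S) ok₀ refl p∈S)
    (Reach-lift (PathWithin⇒Reach t (drop-there p∈S) (PathWithin-drop t ok (λ e → h (suc e)))))
PathWithin⇒Reach (attach t p) {ok} {S = s ∷ S} {suc u} {zero} u∈S h with h zero refl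
... | ok₀ , 0∈S , _ =
  bwd zero (Reach-lift (PathWithin⇒Reach t (drop-there u∈S) (PathWithin-drop t ok (λ e → h (suc e)))))
      ok₀ refl 0∈S

-- Open paths and components

dec-true⁻¹ : ∀ {A : Set} (a? : Dec A) → does a? ≡ true → A
dec-true⁻¹ (yes a) _  = a
dec-true⁻¹ (no _)  ()

Open : ∀ {n} → Tree n → (Fin n → Bool) → Fin (suc n) → Fin (suc n) → Set
Open t y u v = ∀ e → onPath t u v e ≡ true → y e ≡ true

open? : ∀ {n} (t : Tree n) y u v → Dec (Open t y u v)
open? t y u v = all? (λ e → (onPath t u v e ≟ᵇ true) →-dec (y e ≟ᵇ true))

module _ {n} (t : Tree n) (y : Fin n → Bool) where

  Open-refl : ∀ u → Open t y u u
  Open-refl u e q with () ← trans (sym (onPath-self t u e)) q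

  Reach⇒Open : ∀ {S u v} → Reach t y S u v → Open t y u v
  Reach⇒Open r e q = proj₁ (Reach⇒PathWithin r e q)

  Open⇒Reach : ∀ {u v} → Open t y u v → Reach t y ⊤ u v
  Open⇒Reach o = PathWithin⇒Reach t ∈⊤ (λ e q → o e q , ∈⊤ , ∈⊤)

  component : Fin (suc n) → Subset (suc n)
  component u = tabulate (λ v → does (open? t y u v))

  lookup-component : ∀ u v → lookup (component u) v ≡ does (open? t y u v)
  lookup-component u = lookup∘tabulate (λ v → does (open? t y u v))

  Open⇒∈component : ∀ {u v} → Open t y u v → v ∈ component u
  Open⇒∈component {u} {v} o =
    lookup⇒[]= v (component u) (trans (lookup-component u v) (dec-true (open? t y u v) o))

  ∈component⇒Open : ∀ {u v} → v ∈ component u → Open t y u v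
  ∈component⇒Open {u} {v} v∈ =
    dec-true⁻¹ (open? t y u v) (trans (sym (lookup-component u v)) ([]=⇒lookup v∈))

  component-isComponent : ∀ u → IsComponent t y (component u)
  component-isComponent u =
    ((u , u∈) , λ a b a∈ b∈ → Reach-trans (Reach-sym (fromU a∈)) (fromU b∈)) ,
    λ e ye → (λ s∈ → step (fwd e (Open⇒Reach (∈component⇒Open s∈)) ye refl ∈⊤)) ,
             (λ t∈ → step (bwd e (Open⇒Reach (∈component⇒Open t∈)) ye refl ∈⊤))
    where
    u∈ : u ∈ component u
    u∈ = Open⇒∈component (Open-refl u)
    step : ∀ {w} → Reach t y ⊤ u w → w ∈ component u
    step = Open⇒∈component ∘ Reach⇒Open
    fromU : ∀ {w} → w ∈ component u → Reach t y (component u) u w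
    fromU = Reach-restrict step ∘ Open⇒Reach ∘ ∈component⇒Open

  isComponent⇒≡component : ∀ {S u} → IsComponent t y S → u ∈ S → S ≡ component u
  isComponent⇒≡component {S} {u} ((_ , connected) , closed) u∈S = ⊆-antisym
    (λ x∈S → Open⇒∈component (Reach⇒Open (connected u _ u∈S x∈S)))
    (λ x∈ → Reach-closed closed u∈S (Open⇒Reach (∈component⇒Open x∈)))

  isComponent? : ∀ S → Dec (IsComponent t y S)
  isComponent? S = map′
    (λ { (u , refl) → component-isComponent u })
    (λ ic → let (u , u∈S) = proj₁ (proj₁ ic) in u , isComponent⇒≡component ic u∈S)
    (any? (λ u → ≡-dec _≟ᵇ_ S (component u)))

module _ {A : Set} (f : A → ℕ) where

  ∈⇒≤sum-map : ∀ {x xs} → x ∈ˡ xs → f x ≤ sum (map f xs)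
  ∈⇒≤sum-map {xs = x ∷ xs} (here refl) = m≤m+n (f x) _
  ∈⇒≤sum-map {xs = y ∷ xs} (there x∈) = ≤-trans (∈⇒≤sum-map x∈) (m≤n+m _ (f y))

  sum-map≢0⇒∃ : ∀ xs → sum (map f xs) ≢ 0 → ∃ λ x → f x ≢ 0
  sum-map≢0⇒∃ []       s≢0 = contradiction refl s≢0
  sum-map≢0⇒∃ (x ∷ xs) s≢0 with f x ≟ℕ 0
  ... | no fx≢0 = x , fx≢0
  ... | yes fx≡0 = sum-map≢0⇒∃ xs (λ s≡0 → s≢0 (cong₂ ℕ._+_ fx≡0 s≡0))

  sum-map≥2 : ∀ {x z xs} → x ∈ˡ xs → z ∈ˡ xs → x ≢ z → f x ≢ 0 → f z ≢ 0 → 2 ≤ sum (map f xs)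
  sum-map≥2 (here refl) (here refl) x≢z _ _ = contradiction refl x≢z
  sum-map≥2 (here refl) (there z∈) _ fx≢0 fz≢0 =
    +-mono-≤ (n≢0⇒n>0 fx≢0) (≤-trans (n≢0⇒n>0 fz≢0) (∈⇒≤sum-map z∈))
  sum-map≥2 (there x∈) (here refl) _ fx≢0 fz≢0 =
    +-mono-≤ (n≢0⇒n>0 fz≢0) (≤-trans (n≢0⇒n>0 fx≢0) (∈⇒≤sum-map x∈))
  sum-map≥2 {xs = y ∷ _} (there x∈) (there z∈) x≢z fx≢0 fz≢0 =
    ≤-trans (sum-map≥2 x∈ z∈ x≢z fx≢0 fz≢0) (m≤n+m _ (f y))

  sum-map-0 : (∀ x → f x ≡ 0) → ∀ xs → sum (map f xs) ≡ 0
  sum-map-0 f≡0 []       = refl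
  sum-map-0 f≡0 (x ∷ xs) = cong₂ ℕ._+_ (f≡0 x) (sum-map-0 f≡0 xs)

  product-map-1 : (∀ x → f x ≡ 1) → ∀ xs → product (map f xs) ≡ 1
  product-map-1 f≡1 []       = refl
  product-map-1 f≡1 (x ∷ xs) = cong₂ ℕ._*_ (f≡1 x) (product-map-1 f≡1 xs)

  product-map-0 : ∀ {x xs} → x ∈ˡ xs → f x ≡ 0 → product (map f xs) ≡ 0
  product-map-0 x∈ fx≡0 = 0∣⇒≡0 (∈⇒∣product (subst (_∈ˡ map f _) fx≡0 (∈-map⁺ f x∈)))

sum-map-mono : ∀ {A : Set} {f g : A → ℕ} → (∀ x → f x ≤ g x) → ∀ xs → sum (map f xs) ≤ sum (map g xs)
sum-map-mono f≤g []       = z≤n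
sum-map-mono f≤g (x ∷ xs) = +-mono-≤ (f≤g x) (sum-map-mono f≤g xs)

∈-allSubsets : ∀ {m} (S : Subset m) → S ∈ˡ allSubsets m
∈-allSubsets []          = here refl
∈-allSubsets (false ∷ S) = ∈-++⁺ˡ (∈-map⁺ (false ∷_) (∈-allSubsets S))
∈-allSubsets (true ∷ S)  = ∈-++⁺ʳ (map (false ∷_) (allSubsets _)) (∈-map⁺ (true ∷_) (∈-allSubsets S))

sum-allSubsets-suc : ∀ {m} (f : Subset (suc m) → ℕ) →
  sum (map f (allSubsets (suc m))) ≡
  sum (map (f ∘ (false ∷_)) (allSubsets m)) ℕ.+ sum (map (f ∘ (true ∷_)) (allSubsets m))
sum-allSubsets-suc {m} f = begin
  sum (map f (map (false ∷_) L ++ map (true ∷_) L))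
    ≡⟨ cong sum (map-++ f (map (false ∷_) L) (map (true ∷_) L)) ⟩
  sum (map f (map (false ∷_) L) ++ map f (map (true ∷_) L))
    ≡⟨ sum-++ (map f (map (false ∷_) L)) (map f (map (true ∷_) L)) ⟩
  sum (map f (map (false ∷_) L)) ℕ.+ sum (map f (map (true ∷_) L))
    ≡⟨ sym (cong₂ ℕ._+_ (cong sum (map-∘ L)) (cong sum (map-∘ L))) ⟩
  sum (map (f ∘ (false ∷_)) L) ℕ.+ sum (map (f ∘ (true ∷_)) L) ∎
  where
  open ≡-Reasoning
  L : List (Subset m)
  L = allSubsets m

sum-allSubsets-single : ∀ {m} (S₀ : Subset m) (f : Subset m → ℕ) → (∀ S → S ≢ S₀ → f S ≡ 0) →
  sum (map f (allSubsets m)) ≡ f S₀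
sum-allSubsets-single []          f _   = +-identityʳ (f [])
sum-allSubsets-single (false ∷ S₀) f f≡0 = begin
  sum (map f (allSubsets (suc _)))
    ≡⟨ sum-allSubsets-suc f ⟩
  sum (map (f ∘ (false ∷_)) (allSubsets _)) ℕ.+ sum (map (f ∘ (true ∷_)) (allSubsets _))
    ≡⟨ cong₂ ℕ._+_ (sum-allSubsets-single S₀ (f ∘ (false ∷_)) (λ S S≢ → f≡0 _ (S≢ ∘ ∷-injectiveʳ)))
                   (sum-map-0 (f ∘ (true ∷_)) (λ S → f≡0 _ λ ()) (allSubsets _)) ⟩
  f (false ∷ S₀) ℕ.+ 0
    ≡⟨ +-identityʳ _ ⟩
  f (false ∷ S₀) ∎
  where open ≡-Reasoning
sum-allSubsets-single (true ∷ S₀) f f≡0 = trans (sum-allSubsets-suc f)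
  (cong₂ ℕ._+_ (sum-map-0 (f ∘ (false ∷_)) (λ S → f≡0 _ λ ()) (allSubsets _))
               (sum-allSubsets-single S₀ (f ∘ (true ∷_)) (λ S S≢ → f≡0 _ (S≢ ∘ ∷-injectiveʳ))))

-- Coverage and component indicators

coverageIn : ∀ {m} → List (Subset m) → (Subset m → ℕ) → Fin m → Fin m → ℕ
coverageIn L μ u v = sum (map (λ S → if lookup S u ∧ lookup S v then μ S else 0) L)

coverage : ∀ {m} → (Subset m → ℕ) → Fin m → Fin m → ℕ
coverage = coverageIn (allSubsets _)

coverage-diag : ∀ {m} (μ : Subset m → ℕ) u →
  coverage μ u u ≡ sum (map (λ S → if lookup S u then μ S else 0) (allSubsets m))
coverage-diag μ u = cong sum (map-cong (λ S → if-cong (∧-idem (lookup S u))) (allSubsets _))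

ComponentIndicator : ∀ {n} → Tree n → (Fin n → Bool) → (Subset (suc n) → ℕ) → Set
ComponentIndicator t y λv =
  ∀ S → (IsComponent t y S → λv S ≡ 1) × (¬ IsComponent t y S → λv S ≡ 0)

componentIndicator : ∀ {n} → Tree n → (Fin n → Bool) → Subset (suc n) → ℕ
componentIndicator t y S = if does (isComponent? t y S) then 1 else 0

componentIndicator-correct : ∀ {n} (t : Tree n) y → ComponentIndicator t y (componentIndicator t y)
componentIndicator-correct t y S = indicator (isComponent? t y S)
  where
  indicator : ∀ {A : Set} (a? : Dec A) →
    (A → (if does a? then 1 else 0) ≡ 1) × (¬ A → (if does a? then 1 else 0) ≡ 0)
  indicator (yes a)  = (λ _ → refl) , (λ ¬a → contradiction a ¬a)
  indicator (no ¬a) = (λ a → contradiction a ¬a) , (λ _ → refl)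

module _ (G : OrderedAbelianGroup) where

  open OrderedAbelianGroup G using (Carrier; 0#; -_; isAbelianGroup) renaming (_+_ to infixl 6 _+_)

  infixr 7 _·_
  _·_ : ℕ → Carrier → Carrier
  _·_ = Defs._·_ G

  +-abelianGroup : AbelianGroup _ _
  +-abelianGroup = record
    { Carrier = Carrier ; _≈_ = _≡_ ; _∙_ = _+_ ; ε = 0# ; _⁻¹ = -_ ; isAbelianGroup = isAbelianGroup }

  open AbelianGroup +-abelianGroup using (identityˡ; commutativeMonoid; commutativeSemigroup)
  open import Algebra.Properties.CommutativeSemigroup commutativeSemigroup using (interchange)
  open import Algebra.Properties.CommutativeMonoid.Mult commutativeMonoid
    using (×-homo-+; ×-distrib-+) renaming (_×_ to _×ᴹ_)

  ·≗× : ∀ k x → k · x ≡ k ×ᴹ x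
  ·≗× zero    x = refl
  ·≗× (suc k) x = cong (x +_) (·≗× k x)

  ·-distribˡ-+ : ∀ k x y → k · (x + y) ≡ k · x + k · y
  ·-distribˡ-+ k x y rewrite ·≗× k (x + y) | ·≗× k x | ·≗× k y = ×-distrib-+ x y k

  ·-distribʳ-+ : ∀ k l x → (k ℕ.+ l) · x ≡ k · x + l · x
  ·-distribʳ-+ k l x rewrite ·≗× (k ℕ.+ l) x | ·≗× k x | ·≗× l x = ×-homo-+ x k l

  ·-zeroʳ : ∀ k → k · 0# ≡ 0#
  ·-zeroʳ zero    = refl
  ·-zeroʳ (suc k) = trans (identityˡ _) (·-zeroʳ k)

  ·-if : ∀ k b {x} → k · (if b then x else 0#) ≡ (if b then k · x else 0#)
  ·-if k b = trans (if-float (k ·_) b) (if-cong-else b (·-zeroʳ k))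

  +-if : ∀ b {x y} → (if b then x + y else 0#) ≡ (if b then x else 0#) + (if b then y else 0#)
  +-if true  = refl
  +-if false = sym (identityˡ 0#)

  module _ {A : Set} where

    sumG-map-+ : ∀ (f g : A → Carrier) xs →
      sumG G (map (λ a → f a + g a) xs) ≡ sumG G (map f xs) + sumG G (map g xs)
    sumG-map-+ f g []       = sym (identityˡ 0#)
    sumG-map-+ f g (x ∷ xs) = trans (cong (f x + g x +_) (sumG-map-+ f g xs)) (interchange _ _ _ _)

    ·-sumG-map : ∀ k (f : A → Carrier) xs → k · sumG G (map f xs) ≡ sumG G (map (λ a → k · f a) xs)
    ·-sumG-map k f []       = ·-zeroʳ k
    ·-sumG-map k f (x ∷ xs) = trans (·-distribˡ-+ k (f x) _) (cong (k · f x +_) (·-sumG-map k f xs))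

  module _ {m : ℕ} where

    private
      row : (Fin m → Fin m → Carrier) → Fin m → Carrier
      row f u = sumG G (map (λ v → if toℕ u <ᵇ toℕ v then f u v else 0#) (allFin m))

    sumPairs-cong : ∀ {f g : Fin m → Fin m → Carrier} → (∀ u v → f u v ≡ g u v) →
      sumPairs G f ≡ sumPairs G g
    sumPairs-cong f≡g = cong (sumG G) (map-cong (λ u →
      cong (sumG G) (map-cong (λ v → if-cong-then (toℕ u <ᵇ toℕ v) (f≡g u v)) (allFin m))) (allFin m))

    sumPairs-+ : ∀ (f g : Fin m → Fin m → Carrier) →
      sumPairs G (λ u v → f u v + g u v) ≡ sumPairs G f + sumPairs G g
    sumPairs-+ f g =
      trans (cong (sumG G) (map-cong row-+ (allFin m))) (sumG-map-+ (row f) (row g) (allFin m))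
      where
      row-+ : ∀ u → row (λ u v → f u v + g u v) u ≡ row f u + row g u
      row-+ u = trans (cong (sumG G) (map-cong (λ v → +-if (toℕ u <ᵇ toℕ v)) (allFin m)))
                      (sumG-map-+ _ _ (allFin m))

    ·-sumPairs : ∀ k (f : Fin m → Fin m → Carrier) → k · sumPairs G f ≡ sumPairs G (λ u v → k · f u v)
    ·-sumPairs k f =
      trans (·-sumG-map k (row f) (allFin m)) (cong (sumG G) (map-cong ·-row (allFin m)))
      where
      ·-row : ∀ u → k · row f u ≡ row (λ u v → k · f u v) u
      ·-row u = trans (·-sumG-map k _ (allFin m))
                      (cong (sumG G) (map-cong (λ v → ·-if k (toℕ u <ᵇ toℕ v)) (allFin m)))

  sum-dS≡sumPairs-coverageIn : ∀ {n} (c : Fin (suc n) → Fin (suc n) → Carrier) μ L →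
    sumG G (map (λ S → μ S · dS G c S) L) ≡ sumPairs G (λ u v → coverageIn L μ u v · c u v)
  sum-dS≡sumPairs-coverageIn c μ []      = ·-sumPairs 0 c
  sum-dS≡sumPairs-coverageIn {n} c μ (S ∷ L) = begin
    μ S · dS G c S + sumG G (map (λ S → μ S · dS G c S) L)
      ≡⟨ cong₂ _+_ (·-sumPairs (μ S) (λ u v → term u v (c u v))) (sum-dS≡sumPairs-coverageIn c μ L) ⟩
    sumPairs G (λ u v → μ S · term u v (c u v)) + sumPairs G (λ u v → coverageIn L μ u v · c u v)
      ≡⟨ sym (sumPairs-+ (λ u v → μ S · term u v (c u v)) (λ u v → coverageIn L μ u v · c u v)) ⟩
    sumPairs G (λ u v → μ S · term u v (c u v) + coverageIn L μ u v · c u v)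
      ≡⟨ sumPairs-cong (λ u v → collect (lookup S u) (lookup S v) (coverageIn L μ u v) (c u v)) ⟩
    sumPairs G (λ u v → coverageIn (S ∷ L) μ u v · c u v) ∎
    where
    open ≡-Reasoning
    term : Fin (suc n) → Fin (suc n) → Carrier → Carrier
    term u v x = if lookup S u then (if lookup S v then x else 0#) else 0#
    collect : ∀ a b M x → μ S · (if a then (if b then x else 0#) else 0#) + M · x
                        ≡ ((if a ∧ b then μ S else 0) ℕ.+ M) · x
    collect true  true  M x = sym (·-distribʳ-+ (μ S) M x)
    collect true  false M x = trans (cong (_+ M · x) (·-zeroʳ (μ S))) (identityˡ _)
    collect false b     M x = trans (cong (_+ M · x) (·-zeroʳ (μ S))) (identityˡ _)

  costSPP-coverage : ∀ {n} (c : Fin (suc n) → Fin (suc n) → Carrier) μ →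
    costSPP G c μ ≡ sumPairs G (λ u v → coverage μ u v · c u v)
  costSPP-coverage c μ = sum-dS≡sumPairs-coverageIn c μ (allSubsets _)

  module _ {n} (t : Tree n) (y : Fin n → Bool) {u v : Fin (suc n)} where

    pathProd-open : Open t y u v → pathProd G t y u v ≡ 1
    pathProd-open o = product-map-1 _ (λ e → factor≡1 (onPath t u v e) (y e) (o e)) (allFin n)
      where
      factor≡1 : ∀ a b → (a ≡ true → b ≡ true) → (if a then (if b then 1 else 0) else 1) ≡ 1
      factor≡1 false b     _ = refl
      factor≡1 true  true  _ = refl
      factor≡1 true  false h with () ← h refl

    pathProd-closed : ¬ Open t y u v → pathProd G t y u v ≡ 0
    pathProd-closed ¬o with ¬∀⟶∃¬ n _ (λ e → (onPath t u v e ≟ᵇ true) →-dec (y e ≟ᵇ true)) ¬o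
    ... | e , ¬oe = product-map-0 _ (∈-allFin e) (factor≡0 (onPath t u v e) (y e) ¬oe)
      where
      factor≡0 : ∀ a b → ¬ (a ≡ true → b ≡ true) → (if a then (if b then 1 else 0) else 1) ≡ 0
      factor≡0 false b     h = contradiction (λ ()) h
      factor≡0 true  true  h = contradiction (λ _ → refl) h
      factor≡0 true  false _ = refl

    pathProd-open? : pathProd G t y u v ≡ (if does (open? t y u v) then 1 else 0)
    pathProd-open? = byCases (open? t y u v)
      where
      byCases : (o? : Dec (Open t y u v)) → pathProd G t y u v ≡ (if does o? then 1 else 0)
      byCases (yes o)  = pathProd-open o
      byCases (no ¬o) = pathProd-closed ¬o

  Realises : ∀ {n} → Tree n → (Subset (suc n) → ℕ) → (Fin n → Bool) → Set
  Realises t μ y = ∀ u v → coverage μ u v ≡ pathProd G t y u v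

  realises⇒costSPP≡objY : ∀ {n} (t : Tree n) {μ} y (c : Fin (suc n) → Fin (suc n) → Carrier) →
    Realises t μ y → costSPP G c μ ≡ objY G t c y
  realises⇒costSPP≡objY t y c r =
    trans (costSPP-coverage c _) (sumPairs-cong (λ u v → cong (_· c u v) (r u v)))

  module _ {n} {t : Tree n} {y : Fin n → Bool} {λv : Subset (suc n) → ℕ}
           (ind : ComponentIndicator t y λv) where

    componentIndicator-realises : Realises t λv y
    componentIndicator-realises u v = begin
      coverage λv u v
        ≡⟨ sum-allSubsets-single C _ outside ⟩
      (if lookup C u ∧ lookup C v then λv C else 0)
        ≡⟨ if-cong (cong (_∧ lookup C v) u∈C) ⟩
      (if lookup C v then λv C else 0)
        ≡⟨ if-cong-then (lookup C v) (proj₁ (ind C) (component-isComponent t y u)) ⟩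
      (if lookup C v then 1 else 0)
        ≡⟨ if-cong (lookup-component t y u v) ⟩
      (if does (open? t y u v) then 1 else 0)
        ≡⟨ sym (pathProd-open? t y) ⟩
      pathProd G t y u v ∎
      where
      open ≡-Reasoning
      C : Subset (suc n)
      C = component t y u
      u∈C : lookup C u ≡ true
      u∈C = []=⇒lookup (Open⇒∈component t y (Open-refl t y u))
      outside : ∀ S → S ≢ C → (if lookup S u ∧ lookup S v then λv S else 0) ≡ 0
      outside S S≢C with lookup S u in u∈S
      ... | false = refl
      ... | true  = trans (if-cong-then (lookup S v) λvS≡0) (if-eta (lookup S v))
        where
        λvS≡0 : λv S ≡ 0
        λvS≡0 = proj₂ (ind S) (λ ic → S≢C (isComponent⇒≡component t y ic (lookup⇒[]= u S u∈S)))

    componentIndicator-cost : ∀ c → costSPP G c λv ≡ objY G t c y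
    componentIndicator-cost c = realises⇒costSPP≡objY t y c componentIndicator-realises

    componentIndicator-feasible : FeasibleSPP G t λv
    componentIndicator-feasible = onSubtrees , partition
      where
      onSubtrees : ∀ S → λv S ≢ 0 → IsSubtree t S
      onSubtrees S λvS≢0 with isComponent? t y S
      ... | yes ((inhabited , connected) , _) =
        inhabited , λ a b a∈S b∈S → Reach-weaken (λ _ _ → refl) (connected a b a∈S b∈S)
      ... | no ¬ic = contradiction (proj₂ (ind S) ¬ic) λvS≢0
      partition : ∀ u → sum (map (λ S → if lookup S u then λv S else 0) (allSubsets (suc n))) ≡ 1
      partition u = begin
        sum (map (λ S → if lookup S u then λv S else 0) (allSubsets (suc n)))
          ≡⟨ sym (coverage-diag λv u) ⟩
        coverage λv u u
          ≡⟨ componentIndicator-realises u u ⟩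
        pathProd G t y u u
          ≡⟨ pathProd-open t y (Open-refl t y u) ⟩
        1 ∎
        where open ≡-Reasoning

  -- Feasible partitions

  module _ {n} {t : Tree n} {μ : Subset (suc n) → ℕ} (feasible : FeasibleSPP G t μ) where

    SameBlock : Fin (suc n) → Fin (suc n) → Set
    SameBlock u v = ∃ λ S → μ S ≢ 0 × u ∈ S × v ∈ S

    coverage-diag≡1 : ∀ u → coverage μ u u ≡ 1
    coverage-diag≡1 u = trans (coverage-diag μ u) (proj₂ feasible u)

    coverage≤1 : ∀ u v → coverage μ u v ≤ 1
    coverage≤1 u v =
      ≤-trans (sum-map-mono (λ S → ∧-guard (lookup S u) (lookup S v)) (allSubsets _))
              (≤-reflexive (coverage-diag≡1 u))
      where
      ∧-guard : ∀ a b {k} → (if a ∧ b then k else 0) ≤ (if a ∧ a then k else 0)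
      ∧-guard true  true  = ≤-refl
      ∧-guard true  false = z≤n
      ∧-guard false _     = z≤n

    coverage≢0⇒SameBlock : ∀ {u v} → coverage μ u v ≢ 0 → SameBlock u v
    coverage≢0⇒SameBlock {u} {v} c≢0 with sum-map≢0⇒∃ _ (allSubsets _) c≢0
    ... | S , term≢0 with lookup S u in u∈S | lookup S v in v∈S
    ...   | true  | true  = S , term≢0 , lookup⇒[]= u S u∈S , lookup⇒[]= v S v∈S
    ...   | true  | false = contradiction refl term≢0
    ...   | false | _     = contradiction refl term≢0

    SameBlock⇒coverage≢0 : ∀ {u v} → SameBlock u v → coverage μ u v ≢ 0
    SameBlock⇒coverage≢0 {u} {v} (S , μS≢0 , u∈S , v∈S) c≡0 = μS≢0 (n≤0⇒n≡0 (begin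
      μ S
        ≡⟨ if-cong (cong₂ _∧_ ([]=⇒lookup u∈S) ([]=⇒lookup v∈S)) ⟨
      (if lookup S u ∧ lookup S v then μ S else 0)
        ≤⟨ ∈⇒≤sum-map _ (∈-allSubsets S) ⟩
      coverage μ u v
        ≡⟨ c≡0 ⟩
      0 ∎))
      where open ≤-Reasoning

    SameBlock⇒coverage≡1 : ∀ {u v} → SameBlock u v → coverage μ u v ≡ 1
    SameBlock⇒coverage≡1 {u} {v} sb with n≤1⇒n≡0∨n≡1 (coverage≤1 u v)
    ... | inj₁ c≡0 = contradiction c≡0 (SameBlock⇒coverage≢0 sb)
    ... | inj₂ c≡1 = c≡1

    block-unique : ∀ {u S S′} → μ S ≢ 0 → μ S′ ≢ 0 → u ∈ S → u ∈ S′ → S ≡ S′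
    block-unique {u} {S} {S′} μS≢0 μS′≢0 u∈S u∈S′ with ≡-dec _≟ᵇ_ S S′
    ... | yes S≡S′ = S≡S′
    ... | no S≢S′  = contradiction (begin
      2                               ≤⟨ sum-map≥2 weight (∈-allSubsets S) (∈-allSubsets S′) S≢S′
                                                       (weight≢0 u∈S μS≢0) (weight≢0 u∈S′ μS′≢0) ⟩
      sum (map weight (allSubsets _)) ≡⟨ proj₂ feasible u ⟩
      1                               ∎) (<-irrefl refl)
      where
      open ≤-Reasoning
      weight : Subset (suc n) → ℕ
      weight S = if lookup S u then μ S else 0
      weight≢0 : ∀ {S} → u ∈ S → μ S ≢ 0 → weight S ≢ 0
      weight≢0 u∈S = subst (_≢ 0) (sym (if-cong ([]=⇒lookup u∈S)))

    SameBlock-refl : ∀ u → SameBlock u u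
    SameBlock-refl u = coverage≢0⇒SameBlock (subst (_≢ 0) (sym (coverage-diag≡1 u)) λ ())

    SameBlock-sym : ∀ {u v} → SameBlock u v → SameBlock v u
    SameBlock-sym (S , μS≢0 , u∈S , v∈S) = S , μS≢0 , v∈S , u∈S

    SameBlock-trans : ∀ {u v w} → SameBlock u v → SameBlock v w → SameBlock u w
    SameBlock-trans (S , μS≢0 , u∈S , v∈S) (S′ , μS′≢0 , v∈S′ , w∈S′)
      with refl ← block-unique μS≢0 μS′≢0 v∈S v∈S′ = S , μS≢0 , u∈S , w∈S′

    blockEdges : Fin n → Bool
    blockEdges e = 0 <ᵇ coverage μ (source t e) (target t e)

    blockEdges⇒SameBlock : ∀ {e} → blockEdges e ≡ true → SameBlock (source t e) (target t e)
    blockEdges⇒SameBlock q = coverage≢0⇒SameBlock (n>0⇒n≢0 (<ᵇ⇒< 0 _ (Equivalence.from T-≡ q)))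

    SameBlock⇒blockEdges : ∀ {e} → SameBlock (source t e) (target t e) → blockEdges e ≡ true
    SameBlock⇒blockEdges sb = Equivalence.to T-≡ (<⇒<ᵇ (n≢0⇒n>0 (SameBlock⇒coverage≢0 sb)))

    Reach⇒SameBlock : ∀ {S u v} → Reach t blockEdges S u v → SameBlock u v
    Reach⇒SameBlock (here _)            = SameBlock-refl _
    Reach⇒SameBlock (fwd e r q refl _) = SameBlock-trans (Reach⇒SameBlock r) (blockEdges⇒SameBlock q)
    Reach⇒SameBlock (bwd e r q refl _) =
      SameBlock-trans (Reach⇒SameBlock r) (SameBlock-sym (blockEdges⇒SameBlock q))

    SameBlock⇒Open : ∀ {u v} → SameBlock u v → Open t blockEdges u v
    SameBlock⇒Open (S , μS≢0 , u∈S , v∈S) e q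
      with _ , s∈S , t∈S ← Reach⇒PathWithin (proj₂ (proj₁ feasible S μS≢0) _ _ u∈S v∈S) e q =
      SameBlock⇒blockEdges (S , μS≢0 , s∈S , t∈S)

    feasible-realises : Realises t μ blockEdges
    feasible-realises u v with open? t blockEdges u v
    ... | yes o = trans (SameBlock⇒coverage≡1 (Reach⇒SameBlock (Open⇒Reach t blockEdges o)))
                        (sym (pathProd-open t blockEdges o))
    ... | no ¬o with coverage μ u v ≟ℕ 0
    ...   | yes c≡0 = trans c≡0 (sym (pathProd-closed t blockEdges ¬o))
    ...   | no c≢0  = contradiction (SameBlock⇒Open (coverage≢0⇒SameBlock c≢0)) ¬o

    feasible-cost : ∀ c → costSPP G c μ ≡ objY G t c blockEdges
    feasible-cost c = realises⇒costSPP≡objY t blockEdges c feasible-realises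

lemma1 : (G : OrderedAbelianGroup) → ∀ {n} (t : Tree n)
    (c : Fin (suc n) → Fin (suc n) → OrderedAbelianGroup.Carrier G)
    (y : Fin n → Bool) (λv : Subset (suc n) → ℕ) →
    (∀ S → (IsComponent t y S → λv S ≡ 1) × (¬ IsComponent t y S → λv S ≡ 0)) →
    OptimalY G t c y ⇔ OptimalSPP G t c λv
lemma1 G t c y λv ind = mk⇔
  (λ y-optimal → componentIndicator-feasible G ind , λ μ μ-feasible →
     subst₂ _≤ᴳ_ (sym (componentIndicator-cost G ind c)) (sym (feasible-cost G μ-feasible c))
            (y-optimal (blockEdges G μ-feasible)))
  (λ (_ , λv-optimal) y′ →
     let ind′ = componentIndicator-correct t y′ in
     subst₂ _≤ᴳ_ (componentIndicator-cost G ind c) (componentIndicator-cost G ind′ c)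
            (λv-optimal _ (componentIndicator-feasible G ind′)))
  where
  _≤ᴳ_ : OrderedAbelianGroup.Carrier G → OrderedAbelianGroup.Carrier G → Set
  _≤ᴳ_ = OrderedAbelianGroup._≤_ G
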